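{- Let $\Gamma$ be a PL (in particular, a PLH) valued structure with domain $\mathbb Q$ all of whose cost functions are submodular. Then $\Gamma$ has fully symmetric fractional polymorphisms of all arities.
   Context: A valued structure $\Gamma$ with domain $\mathbb Q$ assigns to each function symbol $f$ of its signature a cost function $f^\Gamma:\mathbb Q^{\mathrm{ar}(f)}\to\mathbb Q\cup\{+\infty\}$ (with $+\infty+c=+\infty$, $c<+\infty$ for $c\in\mathbb Q$). A cost function, viewed as a partial function defined where finite, is PL (piecewise linear) if it is first-order definable over $(\mathbb Q;+,1,\le)$, and PLH if first-order definable over $(\mathbb Q;<,1,(x\mapsto cx)_{c\in\mathbb Q})$; every PLH function is PL. $f$ is submodular if $f(\min(x,y))+f(\max(x,y))\le f(x)+f(y)$ for all $x,y$ (componentwise $\min,\max$). An $m$-ary fractional polymorphism of $\Gamma$ is a map $\omega$ from operations $\mathbb Q^m\to\mathbb Q$ to $\mathbb Q_{\ge0}$ with finite support, total weight $1$, and $\sum_g\omega(g)f^\Gamma(g(a^1,\dots,a^m))\le\frac1m\sum_if^\Gamma(a^i)$ for all cost functions and all $a^1,\dots,a^m$ (componentwise); it is fully symmetric if every operation in its support is invariant under all permutations of its arguments. -}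

module Defs where

open import Level using (0ℓ)
open import Data.Nat as ℕ using (ℕ; zero; suc; NonZero)
open import Data.Integer using (+_)
open import Data.Rational as ℚ using (ℚ; 0ℚ; 1ℚ; _⊓_; _⊔_)
open import Data.Fin using (Fin; zero; suc)
open import Data.Product using (Σ; _×_; _,_; ∃)
open import Data.Sum using (_⊎_)
open import Data.Empty using (⊥)
open import Data.Unit using (⊤)
open import Data.List using (List; []; _∷_; map; foldr)
open import Data.List.Membership.Propositional using (_∈_)
open import Data.Fin.Permutation using (Permutation′; _⟨$⟩ʳ_)
open import Function using (_∘_; _⇔_)
open import Relation.Binary.PropositionalEquality using (_≡_)

data ℚ∞ : Set where
  fin : ℚ → ℚ∞
  ∞   : ℚ∞

infixl 6 _+∞_
_+∞_ : ℚ∞ → ℚ∞ → ℚ∞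
fin x +∞ fin y = fin (x ℚ.+ y)
fin x +∞ ∞     = ∞
∞     +∞ _     = ∞

-- scaling by a rational (only used with positive scalars)
infixl 7 _⊙_
_⊙_ : ℚ → ℚ∞ → ℚ∞
c ⊙ fin x = fin (c ℚ.* x)
c ⊙ ∞     = ∞

infix 4 _≤∞_
data _≤∞_ : ℚ∞ → ℚ∞ → Set where
  fin≤fin : ∀ {x y} → x ℚ.≤ y → fin x ≤∞ fin y
  _≤∞∞    : ∀ x → x ≤∞ ∞

sum∞ : List ℚ∞ → ℚ∞
sum∞ = foldr _+∞_ (fin 0ℚ)

sumℚ : List ℚ → ℚ
sumℚ = foldr ℚ._+_ 0ℚ

sumFin∞ : (m : ℕ) → (Fin m → ℚ∞) → ℚ∞
sumFin∞ zero    f = fin 0ℚ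
sumFin∞ (suc m) f = f zero +∞ sumFin∞ m (f ∘ suc)

CostFunction : ℕ → Set
CostFunction k = (Fin k → ℚ) → ℚ∞

record ValuedStructure : Set₁ where
  field
    Symbol : Set
    ar     : Symbol → ℕ
    ⟦_⟧    : (f : Symbol) → CostFunction (ar f)

data Term (n : ℕ) : Set where
  var  : Fin n → Term n
  one  : Term n
  _⊕_  : Term n → Term n → Term n

data Formula : ℕ → Set where
  _≐_   : ∀ {n} → Term n → Term n → Formula n
  _≤̇_   : ∀ {n} → Term n → Term n → Formula n
  ⊤̇ ⊥̇  : ∀ {n} → Formula n
  ¬̇_    : ∀ {n} → Formula n → Formula n
  _∧̇_ _∨̇_ : ∀ {n} → Formula n → Formula n → Formula n
  ∃̇_ ∀̇_ : ∀ {n} → Formula (suc n) → Formula n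

evalT : ∀ {n} → (Fin n → ℚ) → Term n → ℚ
evalT ρ (var i) = ρ i
evalT ρ one     = 1ℚ
evalT ρ (s ⊕ t) = evalT ρ s ℚ.+ evalT ρ t

extend : ∀ {n} → ℚ → (Fin n → ℚ) → Fin (suc n) → ℚ
extend a ρ zero    = a
extend a ρ (suc i) = ρ i

⟦_⟧F : ∀ {n} → Formula n → (Fin n → ℚ) → Set
⟦ s ≐ t ⟧F ρ  = evalT ρ s ≡ evalT ρ t
⟦ s ≤̇ t ⟧F ρ  = evalT ρ s ℚ.≤ evalT ρ t
⟦ ⊤̇ ⟧F ρ      = ⊤
⟦ ⊥̇ ⟧F ρ      = ⊥
⟦ ¬̇ φ ⟧F ρ    = ⟦ φ ⟧F ρ → ⊥
⟦ φ ∧̇ ψ ⟧F ρ  = ⟦ φ ⟧F ρ × ⟦ ψ ⟧F ρ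
⟦ φ ∨̇ ψ ⟧F ρ  = ⟦ φ ⟧F ρ ⊎ ⟦ ψ ⟧F ρ
⟦ ∃̇ φ ⟧F ρ    = Σ ℚ λ a → ⟦ φ ⟧F (extend a ρ)
⟦ ∀̇ φ ⟧F ρ    = (a : ℚ) → ⟦ φ ⟧F (extend a ρ)

-- A cost function, viewed as the partial function defined where it is
-- finite, is PL iff its graph {(x , y) | f x = y ∈ ℚ} is first-order
-- definable (without parameters) over (ℚ; +, 1, ≤).
-- Variable 0 stands for the value y, variables 1..k for the arguments.
IsPL : ∀ {k} → CostFunction k → Set
IsPL {k} f = Σ (Formula (suc k)) λ φ →
  (x : Fin k → ℚ) (y : ℚ) → ⟦ φ ⟧F (extend y x) ⇔ (f x ≡ fin y)

IsPLStructure : ValuedStructure → Set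
IsPLStructure Γ = ∀ f → IsPL ⟦ f ⟧
  where open ValuedStructure Γ

IsSubmodular : ∀ {k} → CostFunction k → Set
IsSubmodular {k} f = (x y : Fin k → ℚ) →
  f (λ i → x i ⊓ y i) +∞ f (λ i → x i ⊔ y i) ≤∞ f x +∞ f y

Operation : ℕ → Set
Operation m = (Fin m → ℚ) → ℚ

-- An m-ary fractional polymorphism is given by its (finite) support together
-- with the (positive) weights, as a list of weighted operations.
WeightedOps : ℕ → Set
WeightedOps m = List (ℚ × Operation m)

weight : ∀ {m} → ℚ × Operation m → ℚ
weight (w , _) = w

applyC : ∀ {m k} → Operation m → (Fin m → Fin k → ℚ) → Fin k → ℚ
applyC g a j = g (λ i → a i j)

IsFractionalPolymorphism : (Γ : ValuedStructure) (m : ℕ) .{{_ : NonZero m}} →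
                           WeightedOps m → Set
IsFractionalPolymorphism Γ m ω =
  ((p : ℚ × Operation m) → p ∈ ω → ℚ.Positive (weight p)) ×
  (sumℚ (map weight ω) ≡ 1ℚ) ×
  ((f : Symbol) (a : Fin m → Fin (ar f) → ℚ) →
     sum∞ (map (λ { (w , g) → w ⊙ ⟦ f ⟧ (applyC g a) }) ω)
       ≤∞ ((+ 1) ℚ./ m) ⊙ sumFin∞ m (λ i → ⟦ f ⟧ (a i)))
  where open ValuedStructure Γ

IsFullySymmetric : ∀ {m} → Operation m → Set
IsFullySymmetric {m} g = (π : Permutation′ m) (x : Fin m → ℚ) →
  g (λ i → x (π ⟨$⟩ʳ i)) ≡ g x

IsFullySymmetricFP : (Γ : ValuedStructure) (m : ℕ) .{{_ : NonZero m}} →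
                     WeightedOps m → Set
IsFullySymmetricFP Γ m ω =
  IsFractionalPolymorphism Γ m ω ×
  ((p : ℚ × Operation m) → p ∈ ω → IsFullySymmetric (Data.Product.proj₂ p))

-- The m-ary fractional polymorphism is the uniform distribution on the m
-- order statistics x ↦ i-th smallest of x₁,…,xₘ, which are fully symmetric.
-- Applied coordinatewise to points a¹,…,aᵐ of ℚᵏ, the order statistics are
-- obtained from the aⁱ by a sorting network: a sequence of steps replacing two
-- points x, y by min(x,y), max(x,y).  By submodularity no step increases the
-- total cost Σᵢ f(aⁱ), so the sorted points cost at most as much as the original
-- ones.
module Submission where

open import Defs
open import Data.Nat using (ℕ; NonZero)
open import Data.Product using (Σ)

open import Level using (0ℓ)
open import Data.Nat as ℕ using (zero; suc)
import Data.Nat.Properties as ℕₚ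
open import Data.Integer as ℤ using (+_)
open import Data.Integer.Tactic.RingSolver using (solve-∀)
open import Data.Rational as ℚ using (ℚ; 0ℚ; 1ℚ; _⊓_; _⊔_; _≤_; _<_; _≤?_; _/_)
import Data.Integer.Properties as ℤₚ
import Data.Rational.Properties as ℚₚ
open import Data.Rational.Unnormalised as ℚᵘ using (mkℚᵘ; *≡*)
import Data.Rational.Unnormalised.Properties as ℚᵘₚ
open import Data.Fin using (Fin; zero; suc)
open import Data.Fin.Permutation using (Permutation′; _⟨$⟩ʳ_)
open import Data.Product using (_×_; _,_; proj₂; ∃)
open import Data.Sum using (inj₁; inj₂)
open import Data.Empty using (⊥-elim)
open import Data.Unit using (⊤)
open import Data.List using (map; tabulate)
open import Data.List.Properties using (map-tabulate)
open import Data.List.Membership.Propositional using (_∈_)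
open import Data.List.Membership.Propositional.Properties using (∈-tabulate⁻)
open import Function using (_∘_; const)
open import Relation.Nullary using (yes; no)
open import Relation.Binary.Bundles using (Preorder)
import Relation.Binary.Reasoning.Preorder as PreorderReasoning
open import Relation.Binary.PropositionalEquality
  using (_≡_; refl; sym; trans; cong; isEquivalence; module ≡-Reasoning)
open import Algebra.Properties.CommutativeMonoid.Sum ℕₚ.+-0-commutativeMonoid
  using (sum; sum-permute)

≤∞-refl : ∀ {x} → x ≤∞ x
≤∞-refl {fin x} = fin≤fin ℚₚ.≤-refl
≤∞-refl {∞}     = ∞ ≤∞∞

≤∞-trans : ∀ {x y z} → x ≤∞ y → y ≤∞ z → x ≤∞ z
≤∞-trans     (fin≤fin p) (fin≤fin q) = fin≤fin (ℚₚ.≤-trans p q)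
≤∞-trans {x} _           (_ ≤∞∞)     = x ≤∞∞

≤∞-reflexive : ∀ {x y} → x ≡ y → x ≤∞ y
≤∞-reflexive refl = ≤∞-refl

≤∞-preorder : Preorder 0ℓ 0ℓ 0ℓ
≤∞-preorder = record
  { Carrier    = ℚ∞
  ; _≈_        = _≡_
  ; _≲_        = _≤∞_
  ; isPreorder = record
    { isEquivalence = isEquivalence
    ; reflexive     = ≤∞-reflexive
    ; trans         = ≤∞-trans
    }
  }

module ≤∞-Reasoning = PreorderReasoning ≤∞-preorder

+∞-assoc : ∀ x y z → (x +∞ y) +∞ z ≡ x +∞ (y +∞ z)
+∞-assoc (fin x) (fin y) (fin z) = cong fin (ℚₚ.+-assoc x y z)
+∞-assoc (fin x) (fin y) ∞       = refl
+∞-assoc (fin x) ∞       z       = refl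
+∞-assoc ∞       y       z       = refl

+∞-mono-≤∞ : ∀ {x x′ y y′} → x ≤∞ x′ → y ≤∞ y′ → x +∞ y ≤∞ x′ +∞ y′
+∞-mono-≤∞               (fin≤fin p) (fin≤fin q) = fin≤fin (ℚₚ.+-mono-≤ p q)
+∞-mono-≤∞ {x′ = fin _} {y} (fin≤fin _) (_ ≤∞∞)  = (fin _ +∞ y) ≤∞∞
+∞-mono-≤∞ {x} {∞} {y}   (_ ≤∞∞)     _           = (x +∞ y) ≤∞∞

⊙-distribˡ-+∞ : ∀ c x y → c ⊙ (x +∞ y) ≡ c ⊙ x +∞ c ⊙ y
⊙-distribˡ-+∞ c (fin x) (fin y) = cong fin (ℚₚ.*-distribˡ-+ c x y)
⊙-distribˡ-+∞ c (fin x) ∞       = refl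
⊙-distribˡ-+∞ c ∞       y       = refl

⊙-monoʳ-≤∞ : ∀ c .{{_ : ℚ.NonNegative c}} {x y} → x ≤∞ y → c ⊙ x ≤∞ c ⊙ y
⊙-monoʳ-≤∞ c     (fin≤fin p) = fin≤fin (ℚₚ.*-monoˡ-≤-nonNeg c p)
⊙-monoʳ-≤∞ c {x} (_ ≤∞∞)     = (c ⊙ x) ≤∞∞

⊙-distrib-sumFin∞ : ∀ c n (t : Fin n → ℚ∞) →
                    sumFin∞ n (λ i → c ⊙ t i) ≡ c ⊙ sumFin∞ n t
⊙-distrib-sumFin∞ c zero    t = cong fin (sym (ℚₚ.*-zeroʳ c))
⊙-distrib-sumFin∞ c (suc n) t = begin
  c ⊙ t zero +∞ sumFin∞ n (λ i → c ⊙ t (suc i)) ≡⟨ cong (c ⊙ t zero +∞_) (⊙-distrib-sumFin∞ c n (t ∘ suc)) ⟩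
  c ⊙ t zero +∞ c ⊙ sumFin∞ n (t ∘ suc)         ≡⟨ ⊙-distribˡ-+∞ c (t zero) (sumFin∞ n (t ∘ suc)) ⟨
  c ⊙ sumFin∞ (suc n) t                         ∎
  where open ≡-Reasoning

sum∞-map-tabulate : ∀ {A : Set} {n} (F : A → ℚ∞) (h : Fin n → A) →
                    sum∞ (map F (tabulate h)) ≡ sumFin∞ n (F ∘ h)
sum∞-map-tabulate {n = zero}  F h = refl
sum∞-map-tabulate {n = suc n} F h = cong (F (h zero) +∞_) (sum∞-map-tabulate F (h ∘ suc))

-- One pass of compare-exchange steps: position i receives the minimum and the
-- maximum is carried on.  When w is sorted, this inserts v into w.
insert : ∀ {n} → ℚ → (Fin n → ℚ) → Fin (suc n) → ℚ
insert {zero}  v w zero    = v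
insert {suc n} v w zero    = v ⊓ w zero
insert {suc n} v w (suc i) = insert (v ⊔ w zero) (w ∘ suc) i

sort : ∀ {n} → (Fin n → ℚ) → Fin n → ℚ
sort {zero}  x = x
sort {suc n} x = insert (x zero) (sort (x ∘ suc))

orderStatistic : ∀ {m} → Fin m → Operation m
orderStatistic i x = sort x i

insertPoint : ∀ {n k} → (Fin k → ℚ) → (Fin n → Fin k → ℚ) → Fin (suc n) → Fin k → ℚ
insertPoint v w i j = insert (v j) (λ l → w l j) i

sortPoints : ∀ {n k} → (Fin n → Fin k → ℚ) → Fin n → Fin k → ℚ
sortPoints a i j = sort (λ l → a l j) i

module _ {k} {f : CostFunction k} (f-sub : IsSubmodular f) where
  open ≤∞-Reasoning

  sum-insertPoint≤ : ∀ {n} v (w : Fin n → Fin k → ℚ) →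
    sumFin∞ (suc n) (f ∘ insertPoint v w) ≤∞ f v +∞ sumFin∞ n (f ∘ w)
  sum-insertPoint≤ {zero}  v w = ≤∞-refl
  sum-insertPoint≤ {suc n} v w = begin
    f v⊓w₀ +∞ sumFin∞ (suc n) (f ∘ insertPoint v⊔w₀ (w ∘ suc))
      ≲⟨ +∞-mono-≤∞ ≤∞-refl (sum-insertPoint≤ v⊔w₀ (w ∘ suc)) ⟩
    f v⊓w₀ +∞ (f v⊔w₀ +∞ rest)
      ≡⟨ +∞-assoc (f v⊓w₀) (f v⊔w₀) rest ⟨
    (f v⊓w₀ +∞ f v⊔w₀) +∞ rest
      ≲⟨ +∞-mono-≤∞ (f-sub v (w zero)) ≤∞-refl ⟩
    (f v +∞ f (w zero)) +∞ rest
      ≡⟨ +∞-assoc (f v) (f (w zero)) rest ⟩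
    f v +∞ sumFin∞ (suc n) (f ∘ w)
      ∎
    where
    v⊓w₀ v⊔w₀ : Fin k → ℚ
    v⊓w₀ j = v j ⊓ w zero j
    v⊔w₀ j = v j ⊔ w zero j
    rest : ℚ∞
    rest = sumFin∞ n (f ∘ w ∘ suc)

  sum-sortPoints≤ : ∀ {n} (a : Fin n → Fin k → ℚ) →
                    sumFin∞ n (f ∘ sortPoints a) ≤∞ sumFin∞ n (f ∘ a)
  sum-sortPoints≤ {zero}  a = ≤∞-refl
  sum-sortPoints≤ {suc n} a = begin
    sumFin∞ (suc n) (f ∘ insertPoint (a zero) (sortPoints (a ∘ suc)))
      ≲⟨ sum-insertPoint≤ (a zero) (sortPoints (a ∘ suc)) ⟩
    f (a zero) +∞ sumFin∞ n (f ∘ sortPoints (a ∘ suc))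
      ≲⟨ +∞-mono-≤∞ ≤∞-refl (sum-sortPoints≤ (a ∘ suc)) ⟩
    sumFin∞ (suc n) (f ∘ a)
      ∎

[_≤_] : ℚ → ℚ → ℕ
[ q ≤ t ] with q ≤? t
... | yes _ = 1
... | no  _ = 0

[≤]-refl : ∀ t → [ t ≤ t ] ≡ 1
[≤]-refl t with t ≤? t
... | yes _   = refl
... | no  t≰t = ⊥-elim (t≰t ℚₚ.≤-refl)

[≤]-> : ∀ {q t} → t < q → [ q ≤ t ] ≡ 0
[≤]-> {q} {t} t<q with q ≤? t
... | yes q≤t = ⊥-elim (ℚₚ.<-irrefl refl (ℚₚ.<-≤-trans t<q q≤t))
... | no  _   = refl

[⊓≤]+[⊔≤] : ∀ v w t → [ v ⊓ w ≤ t ] ℕ.+ [ v ⊔ w ≤ t ] ≡ [ v ≤ t ] ℕ.+ [ w ≤ t ]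
[⊓≤]+[⊔≤] v w t with ℚₚ.≤-total v w
... | inj₁ v≤w rewrite ℚₚ.p≤q⇒p⊓q≡p v≤w | ℚₚ.p≤q⇒p⊔q≡q v≤w = refl
... | inj₂ w≤v rewrite ℚₚ.p≥q⇒p⊓q≡q w≤v | ℚₚ.p≥q⇒p⊔q≡p w≤v = ℕₚ.+-comm [ w ≤ t ] [ v ≤ t ]

-- A sorted vector is determined by its counting function, which ignores the order of entries.
count≤ : ∀ {n} → ℚ → (Fin n → ℚ) → ℕ
count≤ t x = sum (λ i → [ x i ≤ t ])

count≤-<-all : ∀ {n t} (x : Fin n → ℚ) → (∀ i → t < x i) → count≤ t x ≡ 0
count≤-<-all {zero}  x t<x = refl
count≤-<-all {suc n} x t<x rewrite [≤]-> (t<x zero) = count≤-<-all (x ∘ suc) (t<x ∘ suc)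

count≤-insert : ∀ {n} t v (w : Fin n → ℚ) → count≤ t (insert v w) ≡ [ v ≤ t ] ℕ.+ count≤ t w
count≤-insert {zero}  t v w = refl
count≤-insert {suc n} t v w = begin
  [ v ⊓ w₀ ≤ t ] ℕ.+ count≤ t (insert (v ⊔ w₀) (w ∘ suc))
    ≡⟨ cong ([ v ⊓ w₀ ≤ t ] ℕ.+_) (count≤-insert t (v ⊔ w₀) (w ∘ suc)) ⟩
  [ v ⊓ w₀ ≤ t ] ℕ.+ ([ v ⊔ w₀ ≤ t ] ℕ.+ count≤ t (w ∘ suc))
    ≡⟨ ℕₚ.+-assoc [ v ⊓ w₀ ≤ t ] _ _ ⟨
  ([ v ⊓ w₀ ≤ t ] ℕ.+ [ v ⊔ w₀ ≤ t ]) ℕ.+ count≤ t (w ∘ suc)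
    ≡⟨ cong (ℕ._+ count≤ t (w ∘ suc)) ([⊓≤]+[⊔≤] v w₀ t) ⟩
  ([ v ≤ t ] ℕ.+ [ w₀ ≤ t ]) ℕ.+ count≤ t (w ∘ suc)
    ≡⟨ ℕₚ.+-assoc [ v ≤ t ] _ _ ⟩
  [ v ≤ t ] ℕ.+ count≤ t w
    ∎
  where
  open ≡-Reasoning
  w₀ = w zero

count≤-sort : ∀ {n} t (x : Fin n → ℚ) → count≤ t (sort x) ≡ count≤ t x
count≤-sort {zero}  t x = refl
count≤-sort {suc n} t x = trans (count≤-insert t (x zero) (sort (x ∘ suc)))
                                (cong ([ x zero ≤ t ] ℕ.+_) (count≤-sort t (x ∘ suc)))

Sorted : ∀ {n} → (Fin n → ℚ) → Set
Sorted {zero}  s = ⊤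
Sorted {suc n} s = (∀ i → s zero ≤ s i) × Sorted (s ∘ suc)

insert-lowerBound : ∀ {n b v} (w : Fin n → ℚ) → b ≤ v → (∀ i → b ≤ w i) →
                    ∀ i → b ≤ insert v w i
insert-lowerBound {zero}  w b≤v b≤w zero    = b≤v
insert-lowerBound {suc n} w b≤v b≤w zero    = ℚₚ.⊓-glb b≤v (b≤w zero)
insert-lowerBound {suc n} {v = v} w b≤v b≤w (suc i) =
  insert-lowerBound (w ∘ suc) (ℚₚ.≤-trans b≤v (ℚₚ.p≤p⊔q v (w zero))) (b≤w ∘ suc) i

insert-sorted : ∀ {n} v (w : Fin n → ℚ) → Sorted w → Sorted (insert v w)
insert-sorted {zero}  v w _            = (λ { zero → ℚₚ.≤-refl }) , _
insert-sorted {suc n} v w (w₀≤w , w′↑) = head≤ , insert-sorted (v ⊔ w zero) (w ∘ suc) w′↑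
  where
  head≤ : ∀ i → v ⊓ w zero ≤ insert v w i
  head≤ zero    = ℚₚ.≤-refl
  head≤ (suc i) = insert-lowerBound (w ∘ suc)
    (ℚₚ.≤-trans (ℚₚ.p⊓q≤p v (w zero)) (ℚₚ.p≤p⊔q v (w zero)))
    (λ j → ℚₚ.≤-trans (ℚₚ.p⊓q≤q v (w zero)) (w₀≤w (suc j))) i

sort-sorted : ∀ {n} (x : Fin n → ℚ) → Sorted (sort x)
sort-sorted {zero}  x = _
sort-sorted {suc n} x = insert-sorted (x zero) (sort (x ∘ suc)) (sort-sorted (x ∘ suc))

-- Counting the entries ≤ s₀ of s: the count is positive, so s′ cannot lie entirely above s₀.
sorted-head≤ : ∀ {n} (s s′ : Fin (suc n) → ℚ) → Sorted s′ →
               (∀ t → count≤ t s ≡ count≤ t s′) → s′ zero ≤ s zero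
sorted-head≤ {n} s s′ (s′₀≤s′ , _) same with s′ zero ≤? s zero
... | yes s′₀≤s₀ = s′₀≤s₀
... | no  s′₀≰s₀ = ⊥-elim (ℕₚ.1+n≢0 (begin
  suc (count≤ s₀ (s ∘ suc))               ≡⟨ cong (ℕ._+ count≤ s₀ (s ∘ suc)) ([≤]-refl s₀) ⟨
  count≤ s₀ s                             ≡⟨ same s₀ ⟩
  count≤ s₀ s′                            ≡⟨ count≤-<-all s′ (λ i → ℚₚ.<-≤-trans (ℚₚ.≰⇒> s′₀≰s₀) (s′₀≤s′ i)) ⟩
  0                                       ∎))
  where
  open ≡-Reasoning
  s₀ = s zero

sorted-unique : ∀ {n} (s s′ : Fin n → ℚ) → Sorted s → Sorted s′ →
                (∀ t → count≤ t s ≡ count≤ t s′) → ∀ i → s i ≡ s′ i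
sorted-unique {suc n} s s′ s↑ s′↑ same zero    =
  ℚₚ.≤-antisym (sorted-head≤ s′ s s↑ (sym ∘ same)) (sorted-head≤ s s′ s′↑ same)
sorted-unique {suc n} s s′ s↑ s′↑ same (suc i) =
  sorted-unique (s ∘ suc) (s′ ∘ suc) (proj₂ s↑) (proj₂ s′↑) same-tail i
  where
  s₀≡s′₀ : s zero ≡ s′ zero
  s₀≡s′₀ = sorted-unique s s′ s↑ s′↑ same zero
  same-tail : ∀ t → count≤ t (s ∘ suc) ≡ count≤ t (s′ ∘ suc)
  same-tail t = ℕₚ.+-cancelˡ-≡ [ s zero ≤ t ] _ _
    (trans (same t) (cong (λ z → [ z ≤ t ] ℕ.+ count≤ t (s′ ∘ suc)) (sym s₀≡s′₀)))

sort-permute : ∀ {m} (π : Permutation′ m) (x : Fin m → ℚ) i →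
               sort (λ l → x (π ⟨$⟩ʳ l)) i ≡ sort x i
sort-permute π x = sorted-unique _ _ (sort-sorted x∘π) (sort-sorted x) λ t → begin
  count≤ t (sort x∘π) ≡⟨ count≤-sort t x∘π ⟩
  count≤ t x∘π        ≡⟨ sum-permute (λ i → [ x i ≤ t ]) π ⟨
  count≤ t x          ≡⟨ count≤-sort t x ⟨
  count≤ t (sort x)   ∎
  where
  open ≡-Reasoning
  x∘π : Fin _ → ℚ
  x∘π l = x (π ⟨$⟩ʳ l)

orderStatistic-fullySymmetric : ∀ {m} (i : Fin m) → IsFullySymmetric (orderStatistic i)
orderStatistic-fullySymmetric i π x = sort-permute π x i

p/n+q/n≡[p+q]/n : ∀ p q d → p / suc d ℚ.+ q / suc d ≡ (p ℤ.+ q) / suc d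
p/n+q/n≡[p+q]/n p q d = ℚₚ.toℚᵘ-injective (begin
  ℚ.toℚᵘ (p / suc d ℚ.+ q / suc d)              ≈⟨ ℚₚ.toℚᵘ-homo-+ (p / suc d) (q / suc d) ⟩
  ℚ.toℚᵘ (p / suc d) ℚᵘ.+ ℚ.toℚᵘ (q / suc d)    ≈⟨ ℚᵘₚ.+-cong (ℚₚ.toℚᵘ-fromℚᵘ (mkℚᵘ p d))
                                                              (ℚₚ.toℚᵘ-fromℚᵘ (mkℚᵘ q d)) ⟩
  mkℚᵘ p d ℚᵘ.+ mkℚᵘ q d                        ≈⟨ *≡* (cross-multiplied p q (+ suc d)) ⟩
  mkℚᵘ (p ℤ.+ q) d                              ≈⟨ ℚₚ.toℚᵘ-fromℚᵘ (mkℚᵘ (p ℤ.+ q) d) ⟨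
  ℚ.toℚᵘ ((p ℤ.+ q) / suc d)                    ∎)
  where
  open ℚᵘₚ.≃-Reasoning
  cross-multiplied : ∀ p q D → (p ℤ.* D ℤ.+ q ℤ.* D) ℤ.* D ≡ (p ℤ.+ q) ℤ.* (D ℤ.* D)
  cross-multiplied = solve-∀

n/n≡1 : ∀ d → + suc d / suc d ≡ 1ℚ
n/n≡1 d = trans (ℚₚ.fromℚᵘ-cong {mkℚᵘ (+ suc d) d} {mkℚᵘ (+ 1) 0} (*≡* (ℤₚ.*-comm (+ suc d) (+ 1))))
                (ℚₚ.fromℚᵘ-toℚᵘ 1ℚ)

sumℚ-tabulate-1/n : ∀ d n → sumℚ (tabulate {n = n} (const (+ 1 / suc d))) ≡ + n / suc d
sumℚ-tabulate-1/n d zero    = sym (ℚₚ.0/n≡0 (suc d))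
sumℚ-tabulate-1/n d (suc n) =
  trans (cong (+ 1 / suc d ℚ.+_) (sumℚ-tabulate-1/n d n)) (p/n+q/n≡[p+q]/n (+ 1) (+ n) d)

module _ (m : ℕ) .{{_ : NonZero m}} where

  weightedOrderStatistic : Fin m → ℚ × Operation m
  weightedOrderStatistic i = (+ 1 / m , orderStatistic i)

  orderStatistics : WeightedOps m
  orderStatistics = tabulate weightedOrderStatistic

  ∈-orderStatistics : ∀ {p} → p ∈ orderStatistics → ∃ λ i → p ≡ weightedOrderStatistic i
  ∈-orderStatistics = ∈-tabulate⁻

  sum-orderStatistics-cost≤ : ∀ {k} {f : CostFunction k} → IsSubmodular f → (a : Fin m → Fin k → ℚ) →
    sumFin∞ m (λ i → (+ 1 / m) ⊙ f (applyC (orderStatistic i) a)) ≤∞ (+ 1 / m) ⊙ sumFin∞ m (f ∘ a)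
  sum-orderStatistics-cost≤ {f = f} f-sub a = begin
    sumFin∞ m (λ i → (+ 1 / m) ⊙ f (sortPoints a i)) ≡⟨ ⊙-distrib-sumFin∞ (+ 1 / m) m (f ∘ sortPoints a) ⟩
    (+ 1 / m) ⊙ sumFin∞ m (f ∘ sortPoints a)         ≲⟨ ⊙-monoʳ-≤∞ (+ 1 / m) (sum-sortPoints≤ f-sub a) ⟩
    (+ 1 / m) ⊙ sumFin∞ m (f ∘ a)                    ∎
    where
    open ≤∞-Reasoning
    instance
      1/m≥0 : ℚ.NonNegative (+ 1 / m)
      1/m≥0 = ℚₚ.pos⇒nonNeg (+ 1 / m) {{ℚₚ.normalize-pos 1 m}}

sum-weight-orderStatistics : ∀ d → sumℚ (map weight (orderStatistics (suc d))) ≡ 1ℚ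
sum-weight-orderStatistics d = begin
  sumℚ (map weight (orderStatistics (suc d)))
    ≡⟨ cong sumℚ (map-tabulate (weightedOrderStatistic (suc d)) weight) ⟩
  sumℚ (tabulate {n = suc d} (const (+ 1 / suc d)))
    ≡⟨ sumℚ-tabulate-1/n d (suc d) ⟩
  + suc d / suc d
    ≡⟨ n/n≡1 d ⟩
  1ℚ
    ∎
  where open ≡-Reasoning

corollary7p4 : (Γ : ValuedStructure) →
    IsPLStructure Γ →
    ((f : ValuedStructure.Symbol Γ) → IsSubmodular (ValuedStructure.⟦_⟧ Γ f)) →
    (m : ℕ) .{{_ : NonZero m}} →
    Σ (WeightedOps m) (λ ω → IsFullySymmetricFP Γ m ω)
corollary7p4 Γ _ submodular m@(suc d) =
    orderStatistics m
  , ( positive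
    , sum-weight-orderStatistics d
    , λ f a → ≤∞-trans (≤∞-reflexive (sum∞-map-tabulate _ (weightedOrderStatistic m)))
                       (sum-orderStatistics-cost≤ m (submodular f) a) )
  , symmetric
  where
  positive : ∀ p → p ∈ orderStatistics m → ℚ.Positive (weight p)
  positive p p∈ω with ∈-orderStatistics m p∈ω
  ... | _ , refl = ℚₚ.normalize-pos 1 m
  symmetric : ∀ p → p ∈ orderStatistics m → IsFullySymmetric (proj₂ p)
  symmetric p p∈ω with ∈-orderStatistics m p∈ω
  ... | i , refl = orderStatistic-fullySymmetric i
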